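{- Let $n\ge 5$ and let $\sigma$ be a maximal simplex of $\Delta_n=\mathcal{VR}(\mathbb{I}_n;3)$ that covers all places. If $|N(w)\cap\sigma|\ge 2$ for all $w\in\sigma$, then there exist adjacent vertices $v,w\in\sigma$ such that $\sigma=N(v)\cup N(w)$.
   Context: $\mathbb{I}_n$ is the graph on $\{0,1\}^n$, two strings adjacent iff they differ in exactly one coordinate; distance is the number of differing coordinates. $\Delta_n=\mathcal{VR}(\mathbb{I}_n;3)$ is the simplicial complex whose simplices are the sets of vertices with pairwise distance at most $3$. For a vertex $v$, $v(i)$ is its $i$-th coordinate and $N(v)$ is its set of neighbours in $\mathbb{I}_n$. A simplex $\sigma$ covers all places if for each $i\in[n]$ there are $v,w\in\sigma$ with $v(i)=1$ and $w(i)=0$. -}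

module Defs where

open import Data.Nat using (ℕ; zero; suc; _≤_; _+_)
open import Data.Bool using (Bool; true; false; if_then_else_)
open import Data.Vec using (Vec; []; _∷_; lookup)
open import Data.Fin using (Fin)
open import Data.Product using (Σ; ∃; _×_; _,_)
open import Data.Sum using (_⊎_)
open import Relation.Binary.PropositionalEquality using (_≡_; _≢_)
open import Function.Bundles using (_⇔_)

Vertex : ℕ → Set
Vertex n = Vec Bool n

dist : ∀ {n} → Vertex n → Vertex n → ℕ
dist [] [] = 0
dist (true ∷ v) (true ∷ w) = dist v w
dist (false ∷ v) (false ∷ w) = dist v w
dist (true ∷ v) (false ∷ w) = suc (dist v w)
dist (false ∷ v) (true ∷ w) = suc (dist v w)

Adj : ∀ {n} → Vertex n → Vertex n → Set
Adj v w = dist v w ≡ 1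

VSet : ℕ → Set
VSet n = Vertex n → Bool

_∈ₛ_ : ∀ {n} → Vertex n → VSet n → Set
v ∈ₛ σ = σ v ≡ true

_⊆ₛ_ : ∀ {n} → VSet n → VSet n → Set
σ ⊆ₛ τ = ∀ v → v ∈ₛ σ → v ∈ₛ τ

IsSimplex : ∀ {n} → VSet n → Set
IsSimplex {n} σ =
  (Σ (Vertex n) λ v → v ∈ₛ σ) ×
  (∀ v w → v ∈ₛ σ → w ∈ₛ σ → dist v w ≤ 3)

IsMaximalSimplex : ∀ {n} → VSet n → Set
IsMaximalSimplex {n} σ =
  IsSimplex σ × (∀ (τ : VSet n) → IsSimplex τ → σ ⊆ₛ τ → τ ⊆ₛ σ)

CoversAllPlaces : ∀ {n} → VSet n → Set
CoversAllPlaces {n} σ =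
  ∀ (i : Fin n) → Σ (Vertex n) λ v → Σ (Vertex n) λ w →
    v ∈ₛ σ × w ∈ₛ σ × lookup v i ≡ true × lookup w i ≡ false

AtLeastTwoNbrsIn : ∀ {n} → VSet n → Vertex n → Set
AtLeastTwoNbrsIn {n} σ w =
  Σ (Vertex n) λ u₁ → Σ (Vertex n) λ u₂ →
    u₁ ≢ u₂ × Adj w u₁ × Adj w u₂ × u₁ ∈ₛ σ × u₂ ∈ₛ σ

EqNbrUnion : ∀ {n} → VSet n → Vertex n → Vertex n → Set
EqNbrUnion {n} σ v w = ∀ (u : Vertex n) → (u ∈ₛ σ) ⇔ (Adj v u ⊎ Adj w u)

-- Maximality forces σ to contain two vertices x, y at distance 3: otherwise its diameter is
-- at most 2, so it absorbs every neighbour of its vertices, and three successive neighbours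
-- of a vertex already reach distance 3. The three coordinates where x and y differ, together
-- with one coordinate k where they agree, span a 4-dimensional face of 𝕀ₙ; the distance from
-- any vertex s to a face vertex is the distance from s to the face plus a distance inside the
-- face. Since σ covers k, some z ∈ σ has its k-bit flipped relative to x; the bounds
-- d(z, x), d(z, y) ≤ 3 put z on the face. Of the two neighbours of z in σ, at most one flips
-- k back, so a neighbour z′ keeps the k-bit, and the same bounds put z′, and two neighbours
-- each of x and y, on the face. An exhaustive check in 𝕀₄ shows that every vertex within
-- distance 3 of these eight face vertices is adjacent to v or w, the vertices obtained from
-- z and z′ by flipping k. As v and w are adjacent, N(v) ∪ N(w) is a simplex containing σ,
-- and maximality turns this inclusion into an equality.
module Submission where

open import Defs
open import Data.Bool using (Bool; true; false; not; _xor_)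
open import Data.Bool.Properties
  using (xor-assoc; xor-same; xor-identityʳ; xor-inverseʳ; ¬-not) renaming (_≟_ to _≟ᵇ_)
open import Data.Nat using (ℕ; zero; suc; _+_; _≤_; _<_; _≤?_; z≤n; s≤s)
open import Data.Nat.Properties
  using (_≟_; ≤-trans; ≤-reflexive; ≤-pred; ≤∧≢⇒<; m≤n⇒m≤1+n; m≤m+n; m+n≤o⇒m≤o; +-mono-≤;
         +-identityʳ; +-suc; suc-injective; +-cancelʳ-≡; m+n≡0⇒m≡0; m+n≡0⇒n≡0;
         +-commutativeSemigroup; module ≤-Reasoning)
open import Algebra.Properties.CommutativeSemigroup +-commutativeSemigroup using (interchange; x∙yz≈y∙xz)
open import Data.Fin using (Fin; zero; suc)
open import Data.Fin.Properties using () renaming (suc-injective to fsuc-injective)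
open import Data.Vec using (Vec; []; _∷_; lookup; map; head; replicate; _[_]≔_)
open import Data.Vec.Properties using (≡-dec; []≔-commutes; []≔-lookup; lookup∘update; lookup∘update′)
open import Data.Vec.Relation.Unary.All as All using (All; []; _∷_; all?)
import Data.Vec.Relation.Unary.All.Properties as Allₚ
open import Data.Vec.Relation.Unary.Unique.Propositional using (Unique; []; _∷_)
import Data.Vec.Relation.Unary.Unique.Propositional.Properties as Uniqueₚ
open import Data.Product using (Σ; ∃; _×_; _,_; proj₁; proj₂)
open import Data.Sum as Sum using (_⊎_; inj₁; inj₂)
open import Data.Empty using (⊥-elim)
open import Data.Unit using (tt)
open import Function using (_∘_)
open import Function.Bundles using (_⇔_; mk⇔; Equivalence)
open import Relation.Nullary using (Dec; yes; no; ¬_; ¬?; contradiction)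
open import Relation.Nullary.Decidable using (does; map′; _×-dec_; _⊎-dec_; _→-dec_; toWitness)
open import Relation.Unary using (Decidable)
open import Relation.Binary.PropositionalEquality
  using (_≡_; _≢_; refl; sym; trans; cong; cong₂; subst; subst₂; module ≡-Reasoning)

dist-refl : ∀ {n} (v : Vertex n) → dist v v ≡ 0
dist-refl []          = refl
dist-refl (true ∷ v)  = dist-refl v
dist-refl (false ∷ v) = dist-refl v

dist-sym : ∀ {n} (v w : Vertex n) → dist v w ≡ dist w v
dist-sym []          []          = refl
dist-sym (true ∷ v)  (true ∷ w)  = dist-sym v w
dist-sym (true ∷ v)  (false ∷ w) = cong suc (dist-sym v w)
dist-sym (false ∷ v) (true ∷ w)  = cong suc (dist-sym v w)
dist-sym (false ∷ v) (false ∷ w) = dist-sym v w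

dist≡0⇒≡ : ∀ {n} {v w : Vertex n} → dist v w ≡ 0 → v ≡ w
dist≡0⇒≡ {v = []}        {[]}        _ = refl
dist≡0⇒≡ {v = true ∷ v}  {true ∷ w}  e = cong (true ∷_) (dist≡0⇒≡ e)
dist≡0⇒≡ {v = false ∷ v} {false ∷ w} e = cong (false ∷_) (dist≡0⇒≡ e)

dist-∷ : ∀ {n} a b (v w : Vertex n) → dist (a ∷ v) (b ∷ w) ≡ dist (a ∷ []) (b ∷ []) + dist v w
dist-∷ true  true  v w = refl
dist-∷ true  false v w = refl
dist-∷ false true  v w = refl
dist-∷ false false v w = refl

dist-same-∷ : ∀ {n} a (v w : Vertex n) → dist (a ∷ v) (a ∷ w) ≡ dist v w
dist-same-∷ true  v w = refl
dist-same-∷ false v w = refl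

dist-not-∷ : ∀ {n} a (v w : Vertex n) → dist (not a ∷ v) (a ∷ w) ≡ suc (dist v w)
dist-not-∷ true  v w = refl
dist-not-∷ false v w = refl

dist₁-triangle : ∀ a b c → dist (a ∷ []) (c ∷ []) ≤ dist (a ∷ []) (b ∷ []) + dist (b ∷ []) (c ∷ [])
dist₁-triangle true  true  true  = z≤n
dist₁-triangle true  true  false = s≤s z≤n
dist₁-triangle true  false true  = z≤n
dist₁-triangle true  false false = s≤s z≤n
dist₁-triangle false true  true  = s≤s z≤n
dist₁-triangle false true  false = z≤n
dist₁-triangle false false true  = s≤s z≤n
dist₁-triangle false false false = z≤n

dist-triangle : ∀ {n} (u v w : Vertex n) → dist u w ≤ dist u v + dist v w
dist-triangle []      []      []      = z≤n
dist-triangle (a ∷ u) (b ∷ v) (c ∷ w) = begin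
  dist (a ∷ u) (c ∷ w)                    ≡⟨ dist-∷ a c u w ⟩
  δ a c + dist u w                        ≤⟨ +-mono-≤ (dist₁-triangle a b c) (dist-triangle u v w) ⟩
  (δ a b + δ b c) + (dist u v + dist v w) ≡⟨ interchange (δ a b) (δ b c) (dist u v) (dist v w) ⟩
  (δ a b + dist u v) + (δ b c + dist v w) ≡⟨ sym (cong₂ _+_ (dist-∷ a b u v) (dist-∷ b c v w)) ⟩
  dist (a ∷ u) (b ∷ v) + dist (b ∷ v) (c ∷ w) ∎
  where
  open ≤-Reasoning
  δ : Bool → Bool → ℕ
  δ a b = dist (a ∷ []) (b ∷ [])

dist-[]≔ : ∀ {n} (s v : Vertex n) i b →
  dist s (v [ i ]≔ b) ≡ dist (lookup s i ∷ []) (b ∷ []) + dist s (v [ i ]≔ lookup s i)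
dist-[]≔ (a ∷ s) (c ∷ v) zero    b = trans (dist-∷ a b s v) (cong (_ +_) (sym (dist-same-∷ a s v)))
dist-[]≔ (a ∷ s) (c ∷ v) (suc i) b = begin
  dist (a ∷ s) (c ∷ v [ i ]≔ b)                                ≡⟨ dist-∷ a c s _ ⟩
  dist (a ∷ []) (c ∷ []) + dist s (v [ i ]≔ b)                 ≡⟨ cong (_ +_) (dist-[]≔ s v i b) ⟩
  dist (a ∷ []) (c ∷ []) + (δ + dist s (v [ i ]≔ lookup s i))  ≡⟨ x∙yz≈y∙xz (dist (a ∷ []) (c ∷ [])) δ _ ⟩
  δ + (dist (a ∷ []) (c ∷ []) + dist s (v [ i ]≔ lookup s i))  ≡⟨ cong (δ +_) (sym (dist-∷ a c s _)) ⟩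
  δ + dist (a ∷ s) (c ∷ v [ i ]≔ lookup s i)                   ∎
  where
  open ≡-Reasoning
  δ = dist (lookup s i ∷ []) (b ∷ [])

xor-cancelˡ : ∀ a b → a xor (a xor b) ≡ b
xor-cancelˡ a b = trans (sym (xor-assoc a a b)) (cong (_xor b) (xor-same a))

xor-≢ : ∀ {a b} → a ≢ b → a xor b ≡ true
xor-≢ {a} a≢b = trans (cong (a xor_) (¬-not (a≢b ∘ sym))) (xor-inverseʳ a)

dist₁-xor : ∀ a b c → dist (c ∷ []) ((a xor b) ∷ []) ≡ dist ((a xor c) ∷ []) (b ∷ [])
dist₁-xor true  true  true  = refl
dist₁-xor true  true  false = refl
dist₁-xor true  false true  = refl
dist₁-xor true  false false = refl
dist₁-xor false true  true  = refl
dist₁-xor false true  false = refl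
dist₁-xor false false true  = refl
dist₁-xor false false false = refl

-- The face of 𝕀ₙ through x spanned by the coordinates ts, identified with 𝕀ₘ: a face
-- vertex is recorded by which of the coordinates ts are flipped relative to x.
embed : ∀ {n m} → Vertex n → Vec (Fin n) m → Vertex m → Vertex n
embed x []       []      = x
embed x (t ∷ ts) (b ∷ f) = embed x ts f [ t ]≔ (lookup x t xor b)

coords : ∀ {n m} → Vertex n → Vec (Fin n) m → Vertex n → Vertex m
coords x ts s = map (λ t → lookup x t xor lookup s t) ts

offset : ∀ {n m} → Vertex n → Vec (Fin n) m → Vertex n → ℕ
offset x ts s = dist s (embed x ts (coords x ts s))

coords-[]≔ : ∀ {n m} (x s : Vertex n) {t c} {ts : Vec (Fin n) m} →
  All (t ≢_) ts → coords (x [ t ]≔ c) ts s ≡ coords x ts s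
coords-[]≔ x s []                        = refl
coords-[]≔ x s {ts = u ∷ _} (t≢u ∷ t∉ts) =
  cong₂ _∷_ (cong (_xor lookup s u) (lookup∘update′ (t≢u ∘ sym) x _)) (coords-[]≔ x s t∉ts)

embed-[]≔ : ∀ {n m} (x : Vertex n) {t c} (ts : Vec (Fin n) m) f →
  All (t ≢_) ts → embed x ts f [ t ]≔ c ≡ embed (x [ t ]≔ c) ts f
embed-[]≔ x         []       []      []           = refl
embed-[]≔ x {t} {c} (u ∷ ts) (b ∷ f) (t≢u ∷ t∉ts) = begin
  (embed x ts f [ u ]≔ (lookup x u xor b)) [ t ]≔ c ≡⟨ []≔-commutes _ u t (t≢u ∘ sym) ⟩
  (embed x ts f [ t ]≔ c) [ u ]≔ (lookup x u xor b) ≡⟨ cong (_[ u ]≔ _) (embed-[]≔ x ts f t∉ts) ⟩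
  embed (x [ t ]≔ c) ts f [ u ]≔ (lookup x u xor b)
    ≡⟨ cong (λ a → embed _ ts f [ u ]≔ (a xor b)) (sym (lookup∘update′ (t≢u ∘ sym) x c)) ⟩
  embed (x [ t ]≔ c) (u ∷ ts) (b ∷ f)               ∎
  where open ≡-Reasoning

dist-embed : ∀ {n m} (x : Vertex n) {ts : Vec (Fin n) m} → Unique ts → ∀ s f →
  dist s (embed x ts f) ≡ offset x ts s + dist (coords x ts s) f
dist-embed x {[]}     []                 s []      = sym (+-identityʳ _)
dist-embed x {t ∷ ts} (t∉ts ∷ ts-unique) s (b ∷ f) = begin
  dist s (embed x ts f [ t ]≔ (lookup x t xor b))
    ≡⟨ dist-[]≔ s _ t _ ⟩
  dist (lookup s t ∷ []) ((lookup x t xor b) ∷ []) + dist s (embed x ts f [ t ]≔ lookup s t)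
    ≡⟨ cong₂ _+_ (dist₁-xor (lookup x t) b (lookup s t)) (cong (dist s) (embed-[]≔ x ts f t∉ts)) ⟩
  δ + dist s (embed x′ ts f)
    ≡⟨ cong (δ +_) (dist-embed x′ ts-unique s f) ⟩
  δ + (offset x′ ts s + dist (coords x′ ts s) f)
    ≡⟨ cong (λ c → δ + (dist s (embed x′ ts c) + dist c f)) (coords-[]≔ x s t∉ts) ⟩
  δ + (dist s (embed x′ ts cs) + dist cs f)
    ≡⟨ x∙yz≈y∙xz δ (dist s (embed x′ ts cs)) (dist cs f) ⟩
  dist s (embed x′ ts cs) + (δ + dist cs f)
    ≡⟨ cong₂ _+_ (cong (dist s) (sym (embed-[]≔ x ts cs t∉ts)))
                 (sym (dist-∷ (lookup x t xor lookup s t) b cs f)) ⟩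
  dist s (embed x ts cs [ t ]≔ lookup s t) + dist (coords x (t ∷ ts) s) (b ∷ f)
    ≡⟨ cong (λ a → dist s (embed x ts cs [ t ]≔ a) + dist (coords x (t ∷ ts) s) (b ∷ f))
            (sym (xor-cancelˡ (lookup x t) (lookup s t))) ⟩
  offset x (t ∷ ts) s + dist (coords x (t ∷ ts) s) (b ∷ f) ∎
  where
  open ≡-Reasoning
  x′ = x [ t ]≔ lookup s t
  cs = coords x ts s
  δ  = dist ((lookup x t xor lookup s t) ∷ []) (b ∷ [])

coords-embed : ∀ {n m} (x : Vertex n) {ts : Vec (Fin n) m} → Unique ts → ∀ f → coords x ts (embed x ts f) ≡ f
coords-embed x {[]}     []                 []      = refl
coords-embed x {t ∷ ts} (t∉ts ∷ ts-unique) (b ∷ f) = cong₂ _∷_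
  (trans (cong (lookup x t xor_) (lookup∘update t (embed x ts f) c)) (xor-cancelˡ (lookup x t) b))
  (begin
    coords x ts (embed x ts f [ t ]≔ c) ≡⟨ cong (coords x ts) (embed-[]≔ x ts f t∉ts) ⟩
    coords x ts (embed x′ ts f)         ≡⟨ sym (coords-[]≔ x (embed x′ ts f) t∉ts) ⟩
    coords x′ ts (embed x′ ts f)        ≡⟨ coords-embed x′ ts-unique f ⟩
    f                                   ∎)
  where
  open ≡-Reasoning
  c  = lookup x t xor b
  x′ = x [ t ]≔ c

embed-coords : ∀ {n m} (x : Vertex n) (ts : Vec (Fin n) m) {s} →
  offset x ts s ≡ 0 → embed x ts (coords x ts s) ≡ s
embed-coords x ts off≡0 = sym (dist≡0⇒≡ off≡0)

offset-embed : ∀ {n m} (x : Vertex n) {ts : Vec (Fin n) m} → Unique ts → ∀ f → offset x ts (embed x ts f) ≡ 0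
offset-embed x {ts} ts-unique f =
  trans (cong (dist (embed x ts f) ∘ embed x ts) (coords-embed x ts-unique f)) (dist-refl (embed x ts f))

dist-embed-embed : ∀ {n m} (x : Vertex n) {ts : Vec (Fin n) m} → Unique ts → ∀ f g →
  dist (embed x ts f) (embed x ts g) ≡ dist f g
dist-embed-embed x {ts} ts-unique f g = begin
  dist (embed x ts f) (embed x ts g)                               ≡⟨ dist-embed x ts-unique (embed x ts f) g ⟩
  offset x ts (embed x ts f) + dist (coords x ts (embed x ts f)) g
    ≡⟨ cong₂ _+_ (offset-embed x ts-unique f) (cong (λ c → dist c g) (coords-embed x ts-unique f)) ⟩
  dist f g                                                         ∎
  where open ≡-Reasoning

embed-base : ∀ {n m} (x : Vertex n) {ts : Vec (Fin n) m} → Unique ts → embed x ts (replicate m false) ≡ x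
embed-base x {[]}     []                 = refl
embed-base x {t ∷ ts} (t∉ts ∷ ts-unique) = begin
  embed x ts (replicate _ false) [ t ]≔ (lookup x t xor false) ≡⟨ cong (_ [ t ]≔_) (xor-identityʳ _) ⟩
  embed x ts (replicate _ false) [ t ]≔ lookup x t             ≡⟨ embed-[]≔ x ts _ t∉ts ⟩
  embed (x [ t ]≔ lookup x t) ts (replicate _ false)           ≡⟨ cong (λ v → embed v ts _) ([]≔-lookup x t) ⟩
  embed x ts (replicate _ false)                               ≡⟨ embed-base x ts-unique ⟩
  x                                                            ∎
  where open ≡-Reasoning

Differing : ∀ {n} → Vertex n → Vertex n → ℕ → Set
Differing {n} x y d = Σ (Vec (Fin n) d) λ ts → Unique ts × All (λ t → lookup x t ≢ lookup y t) ts

Differing-∷ : ∀ {n d} {x y : Vertex n} a → Differing x y d → Differing (a ∷ x) (a ∷ y) d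
Differing-∷ a (ts , ts-unique , ts-differ) =
  map suc ts , Uniqueₚ.map⁺ fsuc-injective ts-unique , Allₚ.map⁺ ts-differ

Differing-≢∷ : ∀ {n d} {x y : Vertex n} {a b} → a ≢ b → Differing x y d → Differing (a ∷ x) (b ∷ y) (suc d)
Differing-≢∷ a≢b (ts , ts-unique , ts-differ) =
  zero ∷ map suc ts ,
  Allₚ.map⁺ (All.universal (λ _ ()) ts) ∷ Uniqueₚ.map⁺ fsuc-injective ts-unique ,
  a≢b ∷ Allₚ.map⁺ ts-differ

differing-coordinates : ∀ {n} (x y : Vertex n) → Differing x y (dist x y)
differing-coordinates []          []          = [] , [] , []
differing-coordinates (true ∷ x)  (true ∷ y)  = Differing-∷ true (differing-coordinates x y)
differing-coordinates (false ∷ x) (false ∷ y) = Differing-∷ false (differing-coordinates x y)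
differing-coordinates (true ∷ x)  (false ∷ y) = Differing-≢∷ (λ ()) (differing-coordinates x y)
differing-coordinates (false ∷ x) (true ∷ y)  = Differing-≢∷ (λ ()) (differing-coordinates x y)

agreeing-coordinate : ∀ {n} (x y : Vertex n) → dist x y < n → Σ (Fin n) λ k → lookup x k ≡ lookup y k
agreeing-coordinate (true ∷ x)  (true ∷ y)  _         = zero , refl
agreeing-coordinate (false ∷ x) (false ∷ y) _         = zero , refl
agreeing-coordinate (true ∷ x)  (false ∷ y) (s≤s d<n) = let k , agree = agreeing-coordinate x y d<n in suc k , agree
agreeing-coordinate (false ∷ x) (true ∷ y)  (s≤s d<n) = let k , agree = agreeing-coordinate x y d<n in suc k , agree

coords-differing : ∀ {n m} (x y : Vertex n) {ts : Vec (Fin n) m} →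
  All (λ t → lookup x t ≢ lookup y t) ts → coords x ts y ≡ replicate m true
coords-differing x y []                = refl
coords-differing x y (x≢y ∷ ts-differ) = cong₂ _∷_ (xor-≢ x≢y) (coords-differing x y ts-differ)

O Y : Vertex 4
O = replicate 4 false
Y = false ∷ true ∷ true ∷ true ∷ []

-- The window lists a coordinate where x and y agree, then the three where they differ.
window : ∀ {n} (x y : Vertex n) → dist x y ≡ 3 → 3 < n →
  Σ (Vec (Fin n) 4) λ ws → Unique ws × embed x ws Y ≡ y
window {n} x y xy≡3 3<n =
  ws , ws-unique , trans (cong (embed x ws) (sym coords-y)) (embed-coords x ws offset-y)
  where
  differ = subst (Differing x y) xy≡3 (differing-coordinates x y)
  ts = proj₁ differ
  agreeing = agreeing-coordinate x y (subst (_< n) (sym xy≡3) 3<n)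
  k = proj₁ agreeing
  ws = k ∷ ts
  ws-unique : Unique ws
  ws-unique = All.map (λ x≢y k≡t → x≢y (subst (λ i → lookup x i ≡ lookup y i) k≡t (proj₂ agreeing)))
                      (proj₂ (proj₂ differ))
            ∷ proj₁ (proj₂ differ)
  coords-y : coords x ws y ≡ Y
  coords-y = cong₂ _∷_ (trans (cong (lookup x k xor_) (sym (proj₂ agreeing))) (xor-same (lookup x k)))
                       (coords-differing x y (proj₂ (proj₂ differ)))
  offset-y : offset x ws y ≡ 0
  offset-y = +-cancelʳ-≡ 3 (offset x ws y) 0 (begin
    offset x ws y + dist Y O                ≡⟨ cong (λ c → offset x ws y + dist c O) (sym coords-y) ⟩
    offset x ws y + dist (coords x ws y) O  ≡⟨ sym (dist-embed x ws-unique y O) ⟩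
    dist y (embed x ws O)                   ≡⟨ cong (dist y) (embed-base x ws-unique) ⟩
    dist y x                                ≡⟨ dist-sym y x ⟩
    dist x y                                ≡⟨ xy≡3 ⟩
    3                                       ∎)
    where open ≡-Reasoning

covered-head : ∀ {n m} {σ : VSet n} → CoversAllPlaces σ → ∀ x (ws : Vec (Fin n) (suc m)) →
  Σ (Vertex n) λ z → z ∈ₛ σ × head (coords x ws z) ≡ true
covered-head σ-covers x (k ∷ _) with σ-covers k
... | v , w , v∈σ , w∈σ , vk , wk with lookup x k
...   | true  = w , w∈σ , cong (true xor_) wk
...   | false = v , v∈σ , cong (false xor_) vk

_≟ᵥ_ : ∀ {n} → (u v : Vertex n) → Dec (u ≡ v)
_≟ᵥ_ = ≡-dec _≟ᵇ_

∀-vertex? : ∀ {m} {P : Vertex m → Set} → Decidable P → Dec (∀ v → P v)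
∀-vertex? {zero}  P? = map′ (λ p → λ { [] → p }) (λ f → f []) (P? [])
∀-vertex? {suc m} P? =
  map′ (λ (pt , pf) → λ { (true ∷ v) → pt v ; (false ∷ v) → pf v })
       (λ f → (λ v → f (true ∷ v)) , (λ v → f (false ∷ v)))
       (∀-vertex? (P? ∘ (true ∷_)) ×-dec ∀-vertex? (P? ∘ (false ∷_)))

∃-vertex? : ∀ {m} {P : Vertex m → Set} → Decidable P → Dec (∃ P)
∃-vertex? {zero}  P? = map′ ([] ,_) (λ { ([] , p) → p }) (P? [])
∃-vertex? {suc m} P? =
  map′ (λ { (inj₁ (v , p)) → true ∷ v , p ; (inj₂ (v , p)) → false ∷ v , p })
       (λ { (true ∷ v , p) → inj₁ (v , p) ; (false ∷ v , p) → inj₂ (v , p) })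
       (∃-vertex? (P? ∘ (true ∷_)) ⊎-dec ∃-vertex? (P? ∘ (false ∷_)))

_∈?_ : ∀ {n} (v : Vertex n) (σ : VSet n) → Dec (v ∈ₛ σ)
v ∈? σ = σ v ≟ᵇ true

⟦_⟧ : ∀ {n} {P : Vertex n → Set} → Decidable P → VSet n
⟦ P? ⟧ v = does (P? v)

∈⟦⟧ : ∀ {n} {P : Vertex n → Set} (P? : Decidable P) {v} → v ∈ₛ ⟦ P? ⟧ ⇔ P v
∈⟦⟧ P? {v} with P? v
... | yes p = mk⇔ (λ _ → p) (λ _ → refl)
... | no ¬p = mk⇔ (λ ()) (λ p → contradiction p ¬p)

maximal-absorbs : ∀ {n} {σ : VSet n} {p} → IsMaximalSimplex σ → (∀ s → s ∈ₛ σ → dist p s ≤ 3) → p ∈ₛ σ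
maximal-absorbs {σ = σ} {p} ((_ , σ-diam) , σ-max) p-close =
  σ-max τ ((p , p∈τ) , τ-diam) (λ s s∈σ → Equivalence.from (∈⟦⟧ τ?) (inj₁ s∈σ)) p p∈τ
  where
  τ? = λ u → u ∈? σ ⊎-dec u ≟ᵥ p
  τ = ⟦ τ? ⟧
  p∈τ : p ∈ₛ τ
  p∈τ = Equivalence.from (∈⟦⟧ τ?) (inj₂ refl)
  close : ∀ a b → a ∈ₛ σ ⊎ a ≡ p → b ∈ₛ σ ⊎ b ≡ p → dist a b ≤ 3
  close a b (inj₁ a∈σ)  (inj₁ b∈σ)  = σ-diam a b a∈σ b∈σ
  close a _ (inj₁ a∈σ)  (inj₂ refl) = subst (_≤ 3) (dist-sym p a) (p-close a a∈σ)
  close _ b (inj₂ refl) (inj₁ b∈σ)  = p-close b b∈σ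
  close _ _ (inj₂ refl) (inj₂ refl) = subst (_≤ 3) (sym (dist-refl p)) z≤n
  τ-diam : ∀ a b → a ∈ₛ τ → b ∈ₛ τ → dist a b ≤ 3
  τ-diam a b a∈τ b∈τ = close a b (Equivalence.to (∈⟦⟧ τ?) a∈τ) (Equivalence.to (∈⟦⟧ τ?) b∈τ)

maximal-¬diameter≤2 : ∀ {n} {σ : VSet n} → 3 ≤ n → IsMaximalSimplex σ →
  ¬ (∀ x y → x ∈ₛ σ → y ∈ₛ σ → dist x y ≤ 2)
maximal-¬diameter≤2 {σ = σ} (s≤s (s≤s (s≤s _))) σ-max diam≤2 with proj₁ (proj₁ σ-max)
... | a ∷ b ∷ c ∷ r , z∈σ = too-far (subst (_≤ 2) z₃z≡3 (diam≤2 z₃ z z₃∈σ z∈σ))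
  where
  too-far : ¬ 3 ≤ 2
  too-far (s≤s (s≤s ()))
  neighbour∈σ : ∀ {p u} → u ∈ₛ σ → dist p u ≡ 1 → p ∈ₛ σ
  neighbour∈σ {p} {u} u∈σ pu≡1 = maximal-absorbs σ-max λ s s∈σ →
    ≤-trans (dist-triangle p u s) (subst (λ d → d + dist u s ≤ 3) (sym pu≡1) (s≤s (diam≤2 u s u∈σ s∈σ)))
  z z₃ : Vertex _
  z  = a ∷ b ∷ c ∷ r
  z₃ = not a ∷ not b ∷ not c ∷ r
  z₃∈σ : z₃ ∈ₛ σ
  z₃∈σ = neighbour∈σ (neighbour∈σ (neighbour∈σ z∈σ
           (trans (dist-not-∷ a _ _) (cong suc (dist-refl (b ∷ c ∷ r)))))
           (trans (dist-same-∷ (not a) _ _) (trans (dist-not-∷ b _ _) (cong suc (dist-refl (c ∷ r))))))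
           (trans (dist-same-∷ (not a) _ _) (trans (dist-same-∷ (not b) _ _)
             (trans (dist-not-∷ c _ _) (cong suc (dist-refl r)))))
  z₃z≡3 : dist z₃ z ≡ 3
  z₃z≡3 = trans (dist-not-∷ a _ _) (cong suc (trans (dist-not-∷ b _ _) (cong suc
            (trans (dist-not-∷ c _ _) (cong suc (dist-refl r))))))

maximal-distance-3 : ∀ {n} {σ : VSet n} → 3 ≤ n → IsMaximalSimplex σ →
  Σ (Vertex n) λ x → Σ (Vertex n) λ y → x ∈ₛ σ × y ∈ₛ σ × dist x y ≡ 3
maximal-distance-3 {σ = σ} 3≤n σ-max
  with ∃-vertex? (λ x → ∃-vertex? λ y → x ∈? σ ×-dec y ∈? σ ×-dec dist x y ≟ 3)
... | yes pair = pair
... | no ¬pair = ⊥-elim (maximal-¬diameter≤2 3≤n σ-max λ x y x∈σ y∈σ →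
        ≤-pred (≤∧≢⇒< (proj₂ (proj₁ σ-max) x y x∈σ y∈σ) (λ xy≡3 → ¬pair (x , y , x∈σ , y∈σ , xy≡3))))

NbrUnion : ∀ {n} → Vertex n → Vertex n → VSet n
NbrUnion v w = ⟦ (λ u → dist v u ≟ 1 ⊎-dec dist w u ≟ 1) ⟧

∈NbrUnion : ∀ {n} (v w : Vertex n) {u} → u ∈ₛ NbrUnion v w ⇔ (Adj v u ⊎ Adj w u)
∈NbrUnion v w = ∈⟦⟧ (λ u → dist v u ≟ 1 ⊎-dec dist w u ≟ 1)

NbrUnion-simplex : ∀ {n} (v w : Vertex n) → Adj v w → IsSimplex (NbrUnion v w)
NbrUnion-simplex v w vw≡1 = (v , Equivalence.from (∈NbrUnion v w) (inj₂ wv≡1)) , λ a b a∈ b∈ →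
  close a b (Equivalence.to (∈NbrUnion v w) a∈) (Equivalence.to (∈NbrUnion v w) b∈)
  where
  wv≡1 = trans (dist-sym w v) vw≡1
  two-steps : ∀ a b c → dist a b ≡ 1 → dist b c ≡ 1 → dist a c ≤ 2
  two-steps a b c ab≡1 bc≡1 = ≤-trans (dist-triangle a b c) (≤-reflexive (cong₂ _+_ ab≡1 bc≡1))
  three-steps : ∀ a b c d → dist a b ≡ 1 → dist b c ≡ 1 → dist c d ≡ 1 → dist a d ≤ 3
  three-steps a b c d ab≡1 bc≡1 cd≡1 =
    ≤-trans (dist-triangle a b d) (subst (λ e → e + dist b d ≤ 3) (sym ab≡1) (s≤s (two-steps b c d bc≡1 cd≡1)))
  close : ∀ a b → Adj v a ⊎ Adj w a → Adj v b ⊎ Adj w b → dist a b ≤ 3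
  close a b (inj₁ va) (inj₁ vb) = m≤n⇒m≤1+n (two-steps a v b (trans (dist-sym a v) va) vb)
  close a b (inj₁ va) (inj₂ wb) = three-steps a v w b (trans (dist-sym a v) va) vw≡1 wb
  close a b (inj₂ wa) (inj₁ vb) = three-steps a w v b (trans (dist-sym a w) wa) wv≡1 vb
  close a b (inj₂ wa) (inj₂ wb) = m≤n⇒m≤1+n (two-steps a w b (trans (dist-sym a w) wa) wb)

maximal-⊆-NbrUnion : ∀ {n} {σ : VSet n} {v w} → IsMaximalSimplex σ → Adj v w →
  (∀ s → s ∈ₛ σ → Adj v s ⊎ Adj w s) → v ∈ₛ σ × w ∈ₛ σ × EqNbrUnion σ v w
maximal-⊆-NbrUnion {σ = σ} {v} {w} (_ , σ-max) vw≡1 σ⊆N =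
  ∈σ (inj₂ (trans (dist-sym w v) vw≡1)) , ∈σ (inj₁ vw≡1) , λ u → mk⇔ (σ⊆N u) ∈σ
  where
  ∈σ : ∀ {u} → Adj v u ⊎ Adj w u → u ∈ₛ σ
  ∈σ {u} adj = σ-max (NbrUnion v w) (NbrUnion-simplex v w vw≡1)
    (λ s s∈σ → Equivalence.from (∈NbrUnion v w) (σ⊆N s s∈σ)) u (Equivalence.from (∈NbrUnion v w) adj)

flipHead : ∀ {m} → Vertex (suc m) → Vertex (suc m)
flipHead (b ∷ v) = not b ∷ v

dist-flipHead : ∀ {m} (u v : Vertex (suc m)) → dist (flipHead u) (flipHead v) ≡ dist u v
dist-flipHead (true  ∷ u) (true  ∷ v) = refl
dist-flipHead (true  ∷ u) (false ∷ v) = refl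
dist-flipHead (false ∷ u) (true  ∷ v) = refl
dist-flipHead (false ∷ u) (false ∷ v) = refl

adjacent-flipping-head : ∀ {m} (c p : Vertex (suc m)) r →
  head c ≢ head p → r + dist c p ≡ 1 → c ≡ flipHead p × r ≡ 0
adjacent-flipping-head (a ∷ c) (b ∷ p) r a≢b r+d≡1 =
  cong₂ _∷_ (¬-not a≢b) (dist≡0⇒≡ (m+n≡0⇒n≡0 r rest≡0)) , m+n≡0⇒m≡0 r rest≡0
  where
  rest≡0 : r + dist c p ≡ 0
  rest≡0 = suc-injective (begin
    suc (r + dist c p)        ≡⟨ sym (+-suc r (dist c p)) ⟩
    r + suc (dist c p)        ≡⟨ cong (r +_) (sym (trans (cong (λ a → dist (a ∷ c) (b ∷ p)) (¬-not a≢b))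
                                                          (dist-not-∷ b c p))) ⟩
    r + dist (a ∷ c) (b ∷ p)  ≡⟨ r+d≡1 ⟩
    1                         ∎)
    where open ≡-Reasoning

∀-≤3? : {P : ℕ → Set} → (∀ r → Dec (P r)) → Dec (∀ r → r ≤ 3 → P r)
∀-≤3? P? =
  map′ (λ (p₀ , p₁ , p₂ , p₃) → λ { 0 _ → p₀ ; 1 _ → p₁ ; 2 _ → p₂ ; 3 _ → p₃
                                  ; (suc (suc (suc (suc _)))) (s≤s (s≤s (s≤s ()))) })
       (λ f → f 0 z≤n , f 1 (s≤s z≤n) , f 2 (s≤s (s≤s z≤n)) , f 3 (s≤s (s≤s (s≤s z≤n))))
       (P? 0 ×-dec P? 1 ×-dec P? 2 ×-dec P? 3)

-- (c , r) stands for a vertex with face coordinates c at distance r from the face.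
Near : ∀ {k} → ℕ → Vertex 4 → Vec (Vertex 4) k → Set
Near r c = All (λ a → r + dist c a ≤ 3)

near? : ∀ {k} r c (as : Vec (Vertex 4) k) → Dec (Near r c as)
near? r c = all? (λ a → r + dist c a ≤? 3)

head-true⇒offset≡0 : ∀ c → head c ≡ true → ∀ r → r ≤ 3 → Near r c (O ∷ Y ∷ []) → r ≡ 0
head-true⇒offset≡0 = toWitness {a? = ∀-vertex? λ c → head c ≟ᵇ true →-dec
  ∀-≤3? λ r → near? r c (O ∷ Y ∷ []) →-dec r ≟ 0} tt

adjacent-O⇒offset≡0 : ∀ c r → r ≤ 3 → r + dist c O ≡ 1 → Near r c (Y ∷ []) → r ≡ 0
adjacent-O⇒offset≡0 = toWitness {a? = ∀-vertex? λ c →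
  ∀-≤3? λ r → r + dist c O ≟ 1 →-dec near? r c (Y ∷ []) →-dec r ≟ 0} tt

adjacent-Y⇒offset≡0 : ∀ c r → r ≤ 3 → r + dist c Y ≡ 1 → Near r c (O ∷ []) → r ≡ 0
adjacent-Y⇒offset≡0 = toWitness {a? = ∀-vertex? λ c →
  ∀-≤3? λ r → r + dist c Y ≟ 1 →-dec near? r c (O ∷ []) →-dec r ≟ 0} tt

-- Decided by exhaustive search; each hypothesis directly follows the quantifier it
-- constrains so that the search is pruned early.
face-cover :
  ∀ P → head P ≡ true → Near 0 P (O ∷ Y ∷ []) →
  ∀ Q → head Q ≡ true → dist Q P ≡ 1 → Near 0 Q (O ∷ Y ∷ []) →
  ∀ u₁ → dist u₁ O ≡ 1 → Near 0 u₁ (Y ∷ P ∷ Q ∷ []) →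
  ∀ u₂ → dist u₂ O ≡ 1 → u₁ ≢ u₂ → Near 0 u₂ (Y ∷ P ∷ Q ∷ []) →
  ∀ u₃ → dist u₃ Y ≡ 1 → Near 0 u₃ (O ∷ P ∷ Q ∷ []) →
  ∀ u₄ → dist u₄ Y ≡ 1 → u₃ ≢ u₄ → Near 0 u₄ (O ∷ P ∷ Q ∷ []) →
  ∀ c r → r ≤ 3 → Near r c (O ∷ Y ∷ P ∷ Q ∷ u₁ ∷ u₂ ∷ u₃ ∷ u₄ ∷ []) →
  r + dist c (flipHead P) ≡ 1 ⊎ r + dist c (flipHead Q) ≡ 1
face-cover = toWitness {a? =
  ∀-vertex? λ P → head P ≟ᵇ true →-dec near? 0 P (O ∷ Y ∷ []) →-dec
  ∀-vertex? λ Q → head Q ≟ᵇ true →-dec dist Q P ≟ 1 →-dec near? 0 Q (O ∷ Y ∷ []) →-dec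
  ∀-vertex? λ u₁ → dist u₁ O ≟ 1 →-dec near? 0 u₁ (Y ∷ P ∷ Q ∷ []) →-dec
  ∀-vertex? λ u₂ → dist u₂ O ≟ 1 →-dec ¬? (u₁ ≟ᵥ u₂) →-dec near? 0 u₂ (Y ∷ P ∷ Q ∷ []) →-dec
  ∀-vertex? λ u₃ → dist u₃ Y ≟ 1 →-dec near? 0 u₃ (O ∷ P ∷ Q ∷ []) →-dec
  ∀-vertex? λ u₄ → dist u₄ Y ≟ 1 →-dec ¬? (u₃ ≟ᵥ u₄) →-dec near? 0 u₄ (O ∷ P ∷ Q ∷ []) →-dec
  ∀-vertex? λ c → ∀-≤3? λ r → near? r c (O ∷ Y ∷ P ∷ Q ∷ u₁ ∷ u₂ ∷ u₃ ∷ u₄ ∷ []) →-dec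
  (r + dist c (flipHead P) ≟ 1 ⊎-dec r + dist c (flipHead Q) ≟ 1)} tt

module Configuration {n} {σ : VSet n} (σ-max : IsMaximalSimplex σ)
  (σ-two : ∀ w → w ∈ₛ σ → AtLeastTwoNbrsIn σ w)
  (x : Vertex n) {ws : Vec (Fin n) 4} (ws-unique : Unique ws)
  (O∈σ : embed x ws O ∈ₛ σ) (Y∈σ : embed x ws Y ∈ₛ σ)
  (z : Vertex n) (z∈σ : z ∈ₛ σ) (z-head : head (coords x ws z) ≡ true) where

  ι : Vertex 4 → Vertex n
  ι = embed x ws

  π : Vertex n → Vertex 4
  π = coords x ws

  ρ : Vertex n → ℕ
  ρ = offset x ws

  OnFace : Vertex 4 → Set
  OnFace a = ι a ∈ₛ σ

  near : ∀ {k s} → s ∈ₛ σ → {as : Vec (Vertex 4) k} → All OnFace as → Near (ρ s) (π s) as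
  near {s = s} s∈σ = All.map λ {a} a∈σ →
    subst (_≤ 3) (dist-embed x ws-unique s a) (proj₂ (proj₁ σ-max) s (ι a) s∈σ a∈σ)

  near-face : ∀ {k a} → OnFace a → {as : Vec (Vertex 4) k} → All OnFace as → Near 0 a as
  near-face {a = a} a∈σ as∈σ =
    subst₂ (λ r c → Near r c _) (offset-embed x ws-unique a) (coords-embed x ws-unique a) (near a∈σ as∈σ)

  ρ≤3 : ∀ {s} → s ∈ₛ σ → ρ s ≤ 3
  ρ≤3 {s} s∈σ = m+n≤o⇒m≤o (ρ s) (All.head (near s∈σ (O∈σ ∷ [])))

  on-face : ∀ {s} → s ∈ₛ σ → ρ s ≡ 0 → OnFace (π s)
  on-face s∈σ ρ≡0 = subst (_∈ₛ σ) (sym (embed-coords x ws ρ≡0)) s∈σ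

  Adj-ι : ∀ {a s} → Adj (ι a) s ⇔ (ρ s + dist (π s) a ≡ 1)
  Adj-ι {a} {s} = mk⇔ (trans (sym split) ∘ trans (dist-sym s (ι a))) (trans (dist-sym (ι a) s) ∘ trans split)
    where split = dist-embed x ws-unique s a

  adjacent-on-face : ∀ {a s} → s ∈ₛ σ → ρ s ≡ 0 → Adj (ι a) s → OnFace (π s) × dist (π s) a ≡ 1
  adjacent-on-face {a} {s} s∈σ ρ≡0 adj =
    on-face s∈σ ρ≡0 , subst (λ r → r + dist (π s) a ≡ 1) ρ≡0 (Equivalence.to Adj-ι adj)

  TwoFaceNeighbours : Vertex 4 → Set
  TwoFaceNeighbours a = Σ (Vertex 4) λ c₁ → Σ (Vertex 4) λ c₂ →
    dist c₁ a ≡ 1 × OnFace c₁ × dist c₂ a ≡ 1 × c₁ ≢ c₂ × OnFace c₂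

  two-face-neighbours : ∀ {a} → OnFace a → (∀ {s} → s ∈ₛ σ → Adj (ι a) s → ρ s ≡ 0) → TwoFaceNeighbours a
  two-face-neighbours a∈σ neighbours-on-face =
    let u₁ , u₂ , u₁≢u₂ , adj₁ , adj₂ , u₁∈σ , u₂∈σ = σ-two _ a∈σ
        ρ₁ = neighbours-on-face u₁∈σ adj₁
        ρ₂ = neighbours-on-face u₂∈σ adj₂
        on₁ , d₁ = adjacent-on-face u₁∈σ ρ₁ adj₁
        on₂ , d₂ = adjacent-on-face u₂∈σ ρ₂ adj₂
    in π u₁ , π u₂ , d₁ , on₁ , d₂ ,
       (λ eq → u₁≢u₂ (trans (sym (embed-coords x ws ρ₁)) (trans (cong ι eq) (embed-coords x ws ρ₂)))) , on₂

  x-neighbours : TwoFaceNeighbours O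
  x-neighbours = two-face-neighbours O∈σ λ {u} u∈σ adj →
    adjacent-O⇒offset≡0 (π u) (ρ u) (ρ≤3 u∈σ) (Equivalence.to Adj-ι adj) (near u∈σ (Y∈σ ∷ []))

  y-neighbours : TwoFaceNeighbours Y
  y-neighbours = two-face-neighbours Y∈σ λ {u} u∈σ adj →
    adjacent-Y⇒offset≡0 (π u) (ρ u) (ρ≤3 u∈σ) (Equivalence.to Adj-ι adj) (near u∈σ (O∈σ ∷ []))

  P : Vertex 4
  P = π z

  P∈σ : OnFace P
  P∈σ = on-face z∈σ (head-true⇒offset≡0 P z-head (ρ z) (ρ≤3 z∈σ) (near z∈σ (O∈σ ∷ Y∈σ ∷ [])))

  flipped-neighbour : ∀ {u} → Adj (ι P) u → head (π u) ≢ head P → u ≡ ι (flipHead P)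
  flipped-neighbour {u} adj head≢ =
    let πu≡ , ρu≡0 = adjacent-flipping-head (π u) P (ρ u) head≢ (Equivalence.to Adj-ι adj)
    in trans (sym (embed-coords x ws ρu≡0)) (cong ι πu≡)

  same-head-neighbour : Σ (Vertex n) λ s → s ∈ₛ σ × Adj (ι P) s × head (π s) ≡ true
  same-head-neighbour with σ-two (ι P) P∈σ
  ... | u₁ , u₂ , u₁≢u₂ , adj₁ , adj₂ , u₁∈σ , u₂∈σ with head (π u₁) ≟ᵇ head P | head (π u₂) ≟ᵇ head P
  ...   | yes h₁ | _      = u₁ , u₁∈σ , adj₁ , trans h₁ z-head
  ...   | no _   | yes h₂ = u₂ , u₂∈σ , adj₂ , trans h₂ z-head
  ...   | no h₁  | no h₂  = ⊥-elim (u₁≢u₂ (trans (flipped-neighbour adj₁ h₁) (sym (flipped-neighbour adj₂ h₂))))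

  second-face-vertex : Σ (Vertex 4) λ Q → head Q ≡ true × OnFace Q × dist Q P ≡ 1
  second-face-vertex =
    let z′ , z′∈σ , adj , z′-head = same-head-neighbour
        ρz′≡0 = head-true⇒offset≡0 (π z′) z′-head (ρ z′) (ρ≤3 z′∈σ) (near z′∈σ (O∈σ ∷ Y∈σ ∷ []))
    in π z′ , z′-head , adjacent-on-face z′∈σ ρz′≡0 adj

  Q : Vertex 4
  Q = proj₁ second-face-vertex

  v w : Vertex n
  v = ι (flipHead P)
  w = ι (flipHead Q)

  covered : ∀ s → s ∈ₛ σ → Adj v s ⊎ Adj w s
  covered s s∈σ =
    let _ , Q-head , Q∈σ , QP≡1 = second-face-vertex
        u₁ , u₂ , d₁ , on₁ , d₂ , u₁≢u₂ , on₂ = x-neighbours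
        u₃ , u₄ , d₃ , on₃ , d₄ , u₃≢u₄ , on₄ = y-neighbours
    in Sum.map (Equivalence.from Adj-ι) (Equivalence.from Adj-ι) (face-cover
         P z-head (near-face P∈σ (O∈σ ∷ Y∈σ ∷ []))
         Q Q-head QP≡1 (near-face Q∈σ (O∈σ ∷ Y∈σ ∷ []))
         u₁ d₁ (near-face on₁ (Y∈σ ∷ P∈σ ∷ Q∈σ ∷ []))
         u₂ d₂ u₁≢u₂ (near-face on₂ (Y∈σ ∷ P∈σ ∷ Q∈σ ∷ []))
         u₃ d₃ (near-face on₃ (O∈σ ∷ P∈σ ∷ Q∈σ ∷ []))
         u₄ d₄ u₃≢u₄ (near-face on₄ (O∈σ ∷ P∈σ ∷ Q∈σ ∷ []))
         (π s) (ρ s) (ρ≤3 s∈σ) (near s∈σ (O∈σ ∷ Y∈σ ∷ P∈σ ∷ Q∈σ ∷ on₁ ∷ on₂ ∷ on₃ ∷ on₄ ∷ [])))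

  vw-adjacent : Adj v w
  vw-adjacent =
    let _ , _ , _ , QP≡1 = second-face-vertex
    in trans (dist-embed-embed x ws-unique (flipHead P) (flipHead Q))
             (trans (dist-flipHead P Q) (trans (dist-sym P Q) QP≡1))

  adjacent-pair : Σ (Vertex n) λ v → Σ (Vertex n) λ w → v ∈ₛ σ × w ∈ₛ σ × Adj v w × EqNbrUnion σ v w
  adjacent-pair =
    let v∈σ , w∈σ , σ≡N = maximal-⊆-NbrUnion σ-max vw-adjacent covered
    in v , w , v∈σ , w∈σ , vw-adjacent , σ≡N

lemma4p6 : ∀ (n : ℕ) → 5 ≤ n → (σ : VSet n) →
    IsMaximalSimplex σ → CoversAllPlaces σ →
    (∀ w → w ∈ₛ σ → AtLeastTwoNbrsIn σ w) →
    Σ (Vertex n) λ v → Σ (Vertex n) λ w →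
      v ∈ₛ σ × w ∈ₛ σ × Adj v w × EqNbrUnion σ v w
lemma4p6 n 5≤n σ σ-max σ-covers σ-two =
  let x , y , x∈σ , y∈σ , xy≡3 = maximal-distance-3 (≤-trans (m≤m+n 3 2) 5≤n) σ-max
      ws , ws-unique , embedY≡y     = window x y xy≡3 (≤-trans (m≤m+n 4 1) 5≤n)
      z , z∈σ , z-head          = covered-head σ-covers x ws
  in Configuration.adjacent-pair σ-max σ-two x ws-unique
       (subst (_∈ₛ σ) (sym (embed-base x ws-unique)) x∈σ) (subst (_∈ₛ σ) (sym embedY≡y) y∈σ)
       z z∈σ z-head
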